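{- For every $n\ge 3$, let $G_n^6$ be the graph on vertex set $\{c_0,a_1,\dots,a_n,b_1,\dots,b_n\}$ whose non-edges are exactly the $2n+1$ pairs of consecutive vertices on the cycle $c_0,a_1,b_1,a_2,b_2,\dots,a_n,b_n,c_0$ (i.e. $\{c_0,a_1\}$, $\{a_i,b_i\}$ for $1\le i\le n$, $\{b_i,a_{i+1}\}$ for $1\le i\le n-1$, and $\{b_n,c_0\}$), all other pairs of distinct vertices being adjacent. Then $G_n^6$ is word-representable.
   Context: All graphs are finite and simple. For a word $w$ and letters $i,j$, let $w_{ij}$ be the subsequence of $w$ consisting of all occurrences of $i$ and $j$; $i$ and $j$ alternate in $w$ if $w_{ij}$ contains no factor $ii$ or $jj$. A graph $G$ is word-representable if there is a word $w$ over $V(G)$ such that for all distinct $i,j\in V(G)$, $\{i,j\}\in E(G)$ if and only if $i$ and $j$ alternate in $w$. -}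

module Defs where

open import Data.Nat using (ℕ; suc)
open import Data.Fin using (Fin; toℕ)
import Data.Fin.Properties as FinP
open import Data.List using (List; filter)
open import Data.List.Relation.Unary.Linked using (Linked)
open import Data.Product using (_×_; Σ)
open import Data.Sum using (_⊎_)
open import Data.Empty using (⊥)
open import Function.Bundles using (_⇔_)
open import Relation.Nullary using (¬_; yes; no)
open import Relation.Nullary.Decidable using (_⊎-dec_)
open import Relation.Binary.Definitions using (DecidableEquality)
open import Relation.Binary.PropositionalEquality using (_≡_; _≢_; refl; cong)

restrict : {A : Set} → DecidableEquality A → List A → A → A → List A
restrict _≟_ w i j = filter (λ x → (x ≟ i) ⊎-dec (x ≟ j)) w

Alternate : {A : Set} → DecidableEquality A → List A → A → A → Set
Alternate _≟_ w i j = Linked _≢_ (restrict _≟_ w i j)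

WordRepresentable : (V : Set) → DecidableEquality V → (V → V → Set) → Set
WordRepresentable V _≟_ E =
  Σ (List V) λ w → ∀ (i j : V) → i ≢ j → (E i j ⇔ Alternate _≟_ w i j)

data Vtx (n : ℕ) : Set where
  c₀ : Vtx n
  a  : Fin n → Vtx n
  b  : Fin n → Vtx n

_≟V_ : {n : ℕ} → DecidableEquality (Vtx n)
c₀ ≟V c₀ = yes refl
c₀ ≟V a _ = no λ ()
c₀ ≟V b _ = no λ ()
a _ ≟V c₀ = no λ ()
a i ≟V a j with i FinP.≟ j
... | yes refl = yes refl
... | no ne = no λ { refl → ne refl }
a _ ≟V b _ = no λ ()
b _ ≟V c₀ = no λ ()
b _ ≟V a _ = no λ ()
b i ≟V b j with i FinP.≟ j
... | yes refl = yes refl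
... | no ne = no λ { refl → ne refl }

-- Consecutive pairs on the cycle c₀, a₁, b₁, a₂, b₂, …, aₙ, bₙ, c₀
-- (0-based Fin indices: a (k) stands for a_{k+1}, b (k) for b_{k+1}).
CycStep : (n : ℕ) → Vtx n → Vtx n → Set
CycStep n c₀    (a i) = toℕ i ≡ 0
CycStep n (a i) (b j) = i ≡ j
CycStep n (b i) (a j) = suc (toℕ i) ≡ toℕ j
CycStep n (b i) c₀    = suc (toℕ i) ≡ n
CycStep n _     _     = ⊥

NonEdge : (n : ℕ) → Vtx n → Vtx n → Set
NonEdge n u v = CycStep n u v ⊎ CycStep n v u

Edge6 : (n : ℕ) → Vtx n → Vtx n → Set
Edge6 n u v = u ≢ v × ¬ NonEdge n u v

-- Number the cycle c₀, a₁, b₁, …, aₙ, bₙ as 0, 1, …, 2n and take the two permutations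
--   0 2 1 4 3 … 2n 2n−1          (swap 2k−1 ↔ 2k)   and
--   1 0 3 2 … 2n−1 2n−2 2n       (swap 2k ↔ 2k+1, fix 2n).
-- Two vertices of the path 1, …, 2n occur in the same order in both, and so alternate
-- in their concatenation, unless they are consecutive: then exactly one of the swaps
-- reverses them.  Vertex 0 comes first in the first permutation and right after 1 in
-- the second, so it alternates with every vertex but 1; a third 0 inserted just before
-- the final 2n breaks its alternation with 2n and with nothing else.  Hence the word
--   0 2 1 4 3 … 2n 2n−1 · 1 0 3 2 … 2n−1 2n−2 · 0 2n
-- over ℕ represents the complement of the cycle, and it is transported to G_n^6 along
-- the numbering.

{-# OPTIONS --safe #-}
module Submission where

open import Defs
open import Data.Nat using (ℕ; _≤_)
open import Data.Nat as ℕ using (zero; suc; _<_; _*_; _≟_; z≤n; s≤s; s<s; z<s)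
open import Data.Nat.Properties
  using ( suc-injective; *-cancelʳ-≡; *-monoˡ-≤; ≤-refl; ≤-trans; <-trans; <-≤-trans; <⇒≤; <⇒≢; >⇒≢
        ; ≤∧≢⇒<; <-irrefl; <-asym; <-cmp; m≤n⇒m<n∨m≡n; n≤1+n; m<n⇒m<1+n)
open import Data.Fin as Fin using (toℕ)
open import Data.Fin.Properties using (toℕ<n; toℕ-injective)
open import Data.List using (List; []; _∷_; _++_; map; filter; upTo)
open import Data.List.Properties
  using (filter-++; filter-≐; filter-accept; filter-reject; filter-none; upTo-∷ʳ; ++-assoc; map-∘; map-id-local)
open import Data.List.Relation.Unary.All as All using (All; []; _∷_)
open import Data.List.Relation.Unary.All.Properties using (applyUpTo⁺₁; ++⁺; map⁺)
open import Data.List.Relation.Unary.Linked as Linked using (Linked; [-]; _∷_)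
import Data.List.Relation.Unary.Linked.Properties as Linked
open import Data.Product as Product using (_×_; _,_)
open import Data.Sum as Sum using (_⊎_; inj₁; inj₂; [_,_])
open import Function using (_∘_; id)
open import Function.Bundles using (_⇔_; mk⇔; Equivalence)
open import Function.Definitions using (Injective)
open import Relation.Nullary using (¬_; yes; no; contradiction)
open import Relation.Nullary.Decidable using (_⊎-dec_)
open import Relation.Unary using (Decidable)
open import Relation.Binary.Definitions using (DecidableEquality; tri<; tri≈; tri>)
open import Relation.Binary.PropositionalEquality hiding ([_])
open ≡-Reasoning

private variable
  A B : Set

¬linked≢-repeat : ∀ (xs : List A) {z ys} → ¬ Linked _≢_ (xs ++ z ∷ z ∷ ys)
¬linked≢-repeat []       l = Linked.head l refl
¬linked≢-repeat (x ∷ xs) l = ¬linked≢-repeat xs (Linked.tail l)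

filter-map : ∀ {P : B → Set} (P? : Decidable P) (f : A → B) xs →
             filter P? (map f xs) ≡ map f (filter (P? ∘ f) xs)
filter-map P? f []       = refl
filter-map P? f (x ∷ xs) with P? (f x)
... | yes _ = cong (f x ∷_) (filter-map P? f xs)
... | no  _ = filter-map P? f xs

module _ (_≟ᴬ_ : DecidableEquality A) where

  restrict-comm : ∀ w u v → restrict _≟ᴬ_ w u v ≡ restrict _≟ᴬ_ w v u
  restrict-comm w u v = filter-≐ _ _ (Sum.swap , Sum.swap) w

  restrict-++ : ∀ xs ys u v → restrict _≟ᴬ_ (xs ++ ys) u v ≡ restrict _≟ᴬ_ xs u v ++ restrict _≟ᴬ_ ys u v
  restrict-++ xs ys u v = filter-++ _ xs ys

  restrict-accept : ∀ {x} w u v → x ≡ u ⊎ x ≡ v → restrict _≟ᴬ_ (x ∷ w) u v ≡ x ∷ restrict _≟ᴬ_ w u v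
  restrict-accept w u v = filter-accept (λ x → (x ≟ᴬ u) ⊎-dec (x ≟ᴬ v))

  restrict-reject : ∀ {x} w u v → ¬ (x ≡ u ⊎ x ≡ v) → restrict _≟ᴬ_ (x ∷ w) u v ≡ restrict _≟ᴬ_ w u v
  restrict-reject w u v = filter-reject (λ x → (x ≟ᴬ u) ⊎-dec (x ≟ᴬ v))

  alternate-sym : ∀ w u v → Alternate _≟ᴬ_ w u v → Alternate _≟ᴬ_ w v u
  alternate-sym w u v = subst (Linked _≢_) (restrict-comm w u v)

  ¬alternate-++-junction : ∀ w₁ w₂ u v {xs z ys} →
                           restrict _≟ᴬ_ w₁ u v ≡ xs ++ z ∷ [] → restrict _≟ᴬ_ w₂ u v ≡ z ∷ ys →
                           ¬ Alternate _≟ᴬ_ (w₁ ++ w₂) u v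
  ¬alternate-++-junction w₁ w₂ u v {xs} {z} {ys} eq₁ eq₂ =
    ¬linked≢-repeat xs ∘ subst (Linked _≢_) junction
    where
    junction : restrict _≟ᴬ_ (w₁ ++ w₂) u v ≡ xs ++ z ∷ z ∷ ys
    junction = begin
      restrict _≟ᴬ_ (w₁ ++ w₂) u v                   ≡⟨ restrict-++ w₁ w₂ u v ⟩
      restrict _≟ᴬ_ w₁ u v ++ restrict _≟ᴬ_ w₂ u v   ≡⟨ cong₂ _++_ eq₁ eq₂ ⟩
      (xs ++ z ∷ []) ++ z ∷ ys                       ≡⟨ ++-assoc xs (z ∷ []) (z ∷ ys) ⟩
      xs ++ z ∷ z ∷ ys                               ∎

module _ (_≟ᴬ_ : DecidableEquality A) (_≟ᴮ_ : DecidableEquality B)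
         {f : A → B} (f-injective : Injective _≡_ _≡_ f) where

  restrict-map : ∀ w u v → restrict _≟ᴮ_ (map f w) (f u) (f v) ≡ map f (restrict _≟ᴬ_ w u v)
  restrict-map w u v =
    trans (filter-map _ f w) (cong (map f) (filter-≐ _ _ (Sum.map f-injective f-injective , Sum.map (cong f) (cong f)) w))

  alternate-map : ∀ w u v → Alternate _≟ᴬ_ w u v ⇔ Alternate _≟ᴮ_ (map f w) (f u) (f v)
  alternate-map w u v = mk⇔
    (subst (Linked _≢_) (sym (restrict-map w u v)) ∘ Linked.map⁺ ∘ Linked.map (_∘ f-injective))
    (Linked.map (_∘ cong f) ∘ Linked.map⁻ ∘ subst (Linked _≢_) (restrict-map w u v))

restrict-upTo-suc : ∀ m p q →
                    restrict _≟_ (upTo (suc m)) p q ≡ restrict _≟_ (upTo m) p q ++ restrict _≟_ (m ∷ []) p q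
restrict-upTo-suc m p q = begin
  restrict _≟_ (upTo (suc m)) p q                          ≡⟨ cong (λ w → restrict _≟_ w p q) (upTo-∷ʳ m) ⟨
  restrict _≟_ (upTo m ++ m ∷ []) p q                      ≡⟨ restrict-++ _≟_ (upTo m) (m ∷ []) p q ⟩
  restrict _≟_ (upTo m) p q ++ restrict _≟_ (m ∷ []) p q   ∎

restrict-upTo-none : ∀ {m p q} → m ≤ p → m ≤ q → restrict _≟_ (upTo m) p q ≡ []
restrict-upTo-none {m} m≤p m≤q =
  filter-none _ (applyUpTo⁺₁ id m λ i<m → [ <⇒≢ (<-≤-trans i<m m≤p) , <⇒≢ (<-≤-trans i<m m≤q) ])

restrict-upTo-single : ∀ {m p q} → p < m → m ≤ q → restrict _≟_ (upTo m) p q ≡ p ∷ []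
restrict-upTo-single {suc m} {p} {q} (s≤s p≤m) m<q with m≤n⇒m<n∨m≡n p≤m
... | inj₂ refl = begin
  restrict _≟_ (upTo (suc p)) p q                         ≡⟨ restrict-upTo-suc p p q ⟩
  restrict _≟_ (upTo p) p q ++ restrict _≟_ (p ∷ []) p q  ≡⟨ cong₂ _++_ (restrict-upTo-none ≤-refl (<⇒≤ m<q))
                                                                       (restrict-accept _≟_ [] p q (inj₁ refl)) ⟩
  p ∷ []                                                  ∎
... | inj₁ p<m = begin
  restrict _≟_ (upTo (suc m)) p q                         ≡⟨ restrict-upTo-suc m p q ⟩
  restrict _≟_ (upTo m) p q ++ restrict _≟_ (m ∷ []) p q
    ≡⟨ cong₂ _++_ (restrict-upTo-single p<m (<⇒≤ m<q)) (restrict-reject _≟_ [] p q [ >⇒≢ p<m , <⇒≢ m<q ]) ⟩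
  p ∷ []                                                  ∎

restrict-upTo-pair : ∀ {m p q} → p < q → q < m → restrict _≟_ (upTo m) p q ≡ p ∷ q ∷ []
restrict-upTo-pair {suc m} {p} {q} p<q (s≤s q≤m) with m≤n⇒m<n∨m≡n q≤m
... | inj₂ refl = begin
  restrict _≟_ (upTo (suc q)) p q                         ≡⟨ restrict-upTo-suc q p q ⟩
  restrict _≟_ (upTo q) p q ++ restrict _≟_ (q ∷ []) p q  ≡⟨ cong₂ _++_ (restrict-upTo-single p<q ≤-refl)
                                                                       (restrict-accept _≟_ [] p q (inj₂ refl)) ⟩
  p ∷ q ∷ []                                              ∎
... | inj₁ q<m = begin
  restrict _≟_ (upTo (suc m)) p q                         ≡⟨ restrict-upTo-suc m p q ⟩
  restrict _≟_ (upTo m) p q ++ restrict _≟_ (m ∷ []) p q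
    ≡⟨ cong₂ _++_ (restrict-upTo-pair p<q q<m) (restrict-reject _≟_ [] p q [ >⇒≢ (<-trans p<q q<m) , >⇒≢ q<m ]) ⟩
  p ∷ q ∷ []                                              ∎

module _ {f : ℕ → ℕ} (f-involutive : ∀ k → f (f k) ≡ k) where

  private
    f-injective : Injective _≡_ _≡_ f
    f-injective {x} {y} fx≡fy = begin
      x        ≡⟨ f-involutive x ⟨
      f (f x)  ≡⟨ cong f fx≡fy ⟩
      f (f y)  ≡⟨ f-involutive y ⟩
      y        ∎

  restrict-map-upTo : ∀ m x y → restrict _≟_ (map f (upTo m)) x y ≡ map f (restrict _≟_ (upTo m) (f x) (f y))
  restrict-map-upTo m x y = begin
    restrict _≟_ (map f (upTo m)) x y
      ≡⟨ cong₂ (restrict _≟_ (map f (upTo m))) (f-involutive x) (f-involutive y) ⟨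
    restrict _≟_ (map f (upTo m)) (f (f x)) (f (f y))
      ≡⟨ restrict-map _≟_ _≟_ f-injective (upTo m) (f x) (f y) ⟩
    map f (restrict _≟_ (upTo m) (f x) (f y))
      ∎

  restrict-map-upTo-pair : ∀ {m x y} → f x < f y → f y < m → restrict _≟_ (map f (upTo m)) x y ≡ x ∷ y ∷ []
  restrict-map-upTo-pair {m} {x} {y} fx<fy fy<m = begin
    restrict _≟_ (map f (upTo m)) x y          ≡⟨ restrict-map-upTo m x y ⟩
    map f (restrict _≟_ (upTo m) (f x) (f y))  ≡⟨ cong (map f) (restrict-upTo-pair fx<fy fy<m) ⟩
    f (f x) ∷ f (f y) ∷ []                     ≡⟨ cong₂ (λ u v → u ∷ v ∷ []) (f-involutive x) (f-involutive y) ⟩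
    x ∷ y ∷ []                                 ∎

  restrict-map-upTo-single : ∀ {m x y} → f x < m → m ≤ f y → restrict _≟_ (map f (upTo m)) x y ≡ x ∷ []
  restrict-map-upTo-single {m} {x} {y} fx<m m≤fy = begin
    restrict _≟_ (map f (upTo m)) x y          ≡⟨ restrict-map-upTo m x y ⟩
    map f (restrict _≟_ (upTo m) (f x) (f y))  ≡⟨ cong (map f) (restrict-upTo-single fx<m m≤fy) ⟩
    f (f x) ∷ []                               ≡⟨ cong (_∷ []) (f-involutive x) ⟩
    x ∷ []                                     ∎

evenSwap : ℕ → ℕ
evenSwap zero          = 1
evenSwap (suc zero)    = 0
evenSwap (suc (suc k)) = suc (suc (evenSwap k))

oddSwap : ℕ → ℕ
oddSwap zero    = zero
oddSwap (suc k) = suc (evenSwap k)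

evenSwap-involutive : ∀ k → evenSwap (evenSwap k) ≡ k
evenSwap-involutive zero          = refl
evenSwap-involutive (suc zero)    = refl
evenSwap-involutive (suc (suc k)) = cong (suc ∘ suc) (evenSwap-involutive k)

oddSwap-involutive : ∀ k → oddSwap (oddSwap k) ≡ k
oddSwap-involutive zero    = refl
oddSwap-involutive (suc k) = cong suc (evenSwap-involutive k)

evenSwap-double : ∀ n → evenSwap (n * 2) ≡ suc (n * 2)
evenSwap-double zero    = refl
evenSwap-double (suc n) = cong (suc ∘ suc) (evenSwap-double n)

evenSwap-< : ∀ n {k} → k < n * 2 → evenSwap k < n * 2
evenSwap-< (suc n) {zero}        _                = s<s z<s
evenSwap-< (suc n) {suc zero}    _                = z<s
evenSwap-< (suc n) {suc (suc k)} (s<s (s<s k<2n)) = s<s (s<s (evenSwap-< n k<2n))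

oddSwap-≤ : ∀ n {k} → k ≤ n * 2 → oddSwap k ≤ n * 2
oddSwap-≤ n {zero}  _    = z≤n
oddSwap-≤ n {suc k} k<2n = evenSwap-< n k<2n

evenSwap-monotone : ∀ {x y} → x < y → y ≢ suc x → evenSwap x < evenSwap y
evenSwap-monotone {zero}        {suc zero}    _                y≢1   = contradiction refl y≢1
evenSwap-monotone {zero}        {suc (suc y)} _                _     = s<s (s<s z≤n)
evenSwap-monotone {suc zero}    {suc zero}    (s<s ())
evenSwap-monotone {suc zero}    {suc (suc y)} _                _     = z<s
evenSwap-monotone {suc (suc x)} {suc (suc y)} (s<s (s<s x<y)) y≢x+1 =
  s<s (s<s (evenSwap-monotone x<y (y≢x+1 ∘ cong (suc ∘ suc))))

oddSwap-positive : ∀ {x} → 0 < x → 0 < oddSwap x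
oddSwap-positive {suc x} _ = z<s

oddSwap-monotone : ∀ {x y} → x < y → y ≢ suc x → oddSwap x < oddSwap y
oddSwap-monotone {zero}  {suc y} _         _     = z<s
oddSwap-monotone {suc x} {suc y} (s<s x<y) y≢x+1 = s<s (evenSwap-monotone x<y (y≢x+1 ∘ cong suc))

swaps-disagree : ∀ k →
  (oddSwap (suc k) < oddSwap (suc (suc k)) × evenSwap (suc (suc k)) < evenSwap (suc k)) ⊎
  (oddSwap (suc (suc k)) < oddSwap (suc k) × evenSwap (suc k) < evenSwap (suc (suc k)))
swaps-disagree zero          = inj₂ (s<s z<s , z<s)
swaps-disagree (suc zero)    = inj₁ (s<s z<s , s<s (s<s z<s))
swaps-disagree (suc (suc k)) = Sum.map (Product.map shift shift) (Product.map shift shift) (swaps-disagree k)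
  where
  shift : ∀ {x y} → x < y → suc (suc x) < suc (suc y)
  shift = s<s ∘ s<s

CyclicSucc : ℕ → ℕ → ℕ → Set
CyclicSucc m x y = y ≡ suc x ⊎ (x ≡ m × y ≡ 0)

CyclicNeighbours : ℕ → ℕ → ℕ → Set
CyclicNeighbours m x y = CyclicSucc m x y ⊎ CyclicSucc m y x

oddSwaps : ℕ → List ℕ
oddSwaps n = map oddSwap (upTo (suc (n * 2)))

evenSwaps : ℕ → List ℕ
evenSwaps n = map evenSwap (upTo (n * 2))

pathEnds : ℕ → List ℕ
pathEnds n = 0 ∷ n * 2 ∷ []

secondHalf : ℕ → List ℕ
secondHalf n = evenSwaps n ++ pathEnds n

cycleWord : ℕ → List ℕ
cycleWord n = oddSwaps n ++ secondHalf n

module _ (n : ℕ) where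

  restrict-oddSwaps : ∀ {x y} → y ≤ n * 2 → oddSwap x < oddSwap y →
                      restrict _≟_ (oddSwaps n) x y ≡ x ∷ y ∷ []
  restrict-oddSwaps y≤2n lt = restrict-map-upTo-pair oddSwap-involutive lt (s≤s (oddSwap-≤ n y≤2n))

  restrict-evenSwaps : ∀ {x y} → y < n * 2 → evenSwap x < evenSwap y →
                       restrict _≟_ (evenSwaps n) x y ≡ x ∷ y ∷ []
  restrict-evenSwaps y<2n lt = restrict-map-upTo-pair evenSwap-involutive lt (evenSwap-< n y<2n)

  restrict-evenSwaps-last : ∀ {x} → x < n * 2 → restrict _≟_ (evenSwaps n) x (n * 2) ≡ x ∷ []
  restrict-evenSwaps-last x<2n =
    restrict-map-upTo-single evenSwap-involutive (evenSwap-< n x<2n) (subst (n * 2 ≤_) (sym (evenSwap-double n)) (n≤1+n _))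

  evenSwap<evenSwap-last : ∀ {z} → z < n * 2 → evenSwap z < evenSwap (n * 2)
  evenSwap<evenSwap-last z<2n = subst (_ <_) (sym (evenSwap-double n)) (m<n⇒m<1+n (evenSwap-< n z<2n))

  -- evenSwap (n * 2) = suc (n * 2), so the trailing n * 2 extends the permutation evenSwaps n;
  -- the 0 just before it is invisible to path vertices.
  restrict-secondHalf : ∀ {x y} → 0 < x → 0 < y → x ≤ n * 2 → y ≤ n * 2 → evenSwap x < evenSwap y →
                        restrict _≟_ (secondHalf n) x y ≡ x ∷ y ∷ []
  restrict-secondHalf {x} {y} 0<x 0<y x≤2n y≤2n lt with m≤n⇒m<n∨m≡n y≤2n
  ... | inj₁ y<2n = begin
    restrict _≟_ (secondHalf n) x y
      ≡⟨ restrict-++ _≟_ (evenSwaps n) (pathEnds n) x y ⟩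
    restrict _≟_ (evenSwaps n) x y ++ restrict _≟_ (pathEnds n) x y
      ≡⟨ cong₂ _++_ (restrict-evenSwaps y<2n lt) ends ⟩
    (x ∷ y ∷ []) ++ []
      ∎
    where
    x<2n : x < n * 2
    x<2n = ≤∧≢⇒< x≤2n λ x≡2n →
      <-asym lt (subst (λ t → evenSwap y < evenSwap t) (sym x≡2n) (evenSwap<evenSwap-last y<2n))
    ends : restrict _≟_ (pathEnds n) x y ≡ []
    ends = trans (restrict-reject _≟_ (n * 2 ∷ []) x y [ <⇒≢ 0<x , <⇒≢ 0<y ])
                 (restrict-reject _≟_ [] x y [ >⇒≢ x<2n , >⇒≢ y<2n ])
  ... | inj₂ refl = begin
    restrict _≟_ (secondHalf n) x y
      ≡⟨ restrict-++ _≟_ (evenSwaps n) (pathEnds n) x y ⟩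
    restrict _≟_ (evenSwaps n) x y ++ restrict _≟_ (pathEnds n) x y
      ≡⟨ cong₂ _++_ (restrict-evenSwaps-last x<2n) ends ⟩
    (x ∷ []) ++ y ∷ []
      ∎
    where
    x<2n : x < n * 2
    x<2n = ≤∧≢⇒< x≤2n λ { refl → <-irrefl refl lt }
    ends : restrict _≟_ (pathEnds n) x y ≡ y ∷ []
    ends = trans (restrict-reject _≟_ (n * 2 ∷ []) x y [ <⇒≢ 0<x , <⇒≢ 0<y ])
                 (restrict-accept _≟_ [] x y (inj₂ refl))

  restrict-cycleWord : ∀ x y → restrict _≟_ (cycleWord n) x y ≡
                       restrict _≟_ (oddSwaps n) x y ++ restrict _≟_ (evenSwaps n) x y ++ restrict _≟_ (pathEnds n) x y
  restrict-cycleWord x y = trans (restrict-++ _≟_ (oddSwaps n) (secondHalf n) x y)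
                                 (cong (restrict _≟_ (oddSwaps n) x y ++_) (restrict-++ _≟_ (evenSwaps n) (pathEnds n) x y))

  path-alternate : ∀ {x y} → 0 < x → y ≤ n * 2 → x < y → y ≢ suc x → Alternate _≟_ (cycleWord n) x y
  path-alternate {x} {y} 0<x y≤2n x<y y≢x+1 =
    subst (Linked _≢_) (sym restriction) (x≢y ∷ x≢y ∘ sym ∷ x≢y ∷ [-])
    where
    x≢y : x ≢ y
    x≢y = <⇒≢ x<y
    restriction : restrict _≟_ (cycleWord n) x y ≡ x ∷ y ∷ x ∷ y ∷ []
    restriction = trans (restrict-++ _≟_ (oddSwaps n) (secondHalf n) x y)
      (cong₂ _++_ (restrict-oddSwaps y≤2n (oddSwap-monotone x<y y≢x+1))
                  (restrict-secondHalf 0<x (<-trans 0<x x<y) (<⇒≤ (<-≤-trans x<y y≤2n)) y≤2n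
                                       (evenSwap-monotone x<y y≢x+1)))

  path-successor-¬alternate : ∀ {k} → suc (suc k) ≤ n * 2 → ¬ Alternate _≟_ (cycleWord n) (suc k) (suc (suc k))
  path-successor-¬alternate {k} y≤2n with swaps-disagree k
  ... | inj₁ (odd< , even>) =
    ¬alternate-++-junction _≟_ (oddSwaps n) (secondHalf n) x y {xs = x ∷ []}
      (restrict-oddSwaps y≤2n odd<)
      (trans (restrict-comm _≟_ (secondHalf n) x y) (restrict-secondHalf z<s z<s y≤2n (<⇒≤ y≤2n) even>))
    where
    x y : ℕ
    x = suc k
    y = suc (suc k)
  ... | inj₂ (odd> , even<) =
    ¬alternate-++-junction _≟_ (oddSwaps n) (secondHalf n) x y {xs = y ∷ []}
      (trans (restrict-comm _≟_ (oddSwaps n) x y) (restrict-oddSwaps (<⇒≤ y≤2n) odd>))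
      (restrict-secondHalf z<s z<s (<⇒≤ y≤2n) y≤2n even<)
    where
    x y : ℕ
    x = suc k
    y = suc (suc k)

  zero-alternate : ∀ {y} → 1 < y → y < n * 2 → Alternate _≟_ (cycleWord n) 0 y
  zero-alternate {y} 1<y y<2n =
    subst (Linked _≢_) (sym restriction) (0≢y ∷ 0≢y ∘ sym ∷ 0≢y ∷ 0≢y ∘ sym ∷ [-])
    where
    0<y : 0 < y
    0<y = <-trans z<s 1<y
    0≢y : 0 ≢ y
    0≢y = <⇒≢ 0<y
    ends : restrict _≟_ (pathEnds n) 0 y ≡ 0 ∷ []
    ends = trans (restrict-accept _≟_ (n * 2 ∷ []) 0 y (inj₁ refl))
                 (cong (0 ∷_) (restrict-reject _≟_ [] 0 y [ >⇒≢ (<-trans 0<y y<2n) , >⇒≢ y<2n ]))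
    restriction : restrict _≟_ (cycleWord n) 0 y ≡ 0 ∷ y ∷ 0 ∷ y ∷ 0 ∷ []
    restriction = begin
      restrict _≟_ (cycleWord n) 0 y
        ≡⟨ restrict-cycleWord 0 y ⟩
      restrict _≟_ (oddSwaps n) 0 y ++ restrict _≟_ (evenSwaps n) 0 y ++ restrict _≟_ (pathEnds n) 0 y
        ≡⟨ cong₂ _++_ (restrict-oddSwaps (<⇒≤ y<2n) (oddSwap-positive 0<y))
                      (cong₂ _++_ (restrict-evenSwaps y<2n (evenSwap-monotone 0<y (>⇒≢ 1<y))) ends) ⟩
      0 ∷ y ∷ 0 ∷ y ∷ 0 ∷ []
        ∎

  zero-one-¬alternate : 1 ≤ n * 2 → ¬ Alternate _≟_ (cycleWord n) 0 1
  zero-one-¬alternate 1≤2n =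
    ¬alternate-++-junction _≟_ (oddSwaps n) (secondHalf n) 0 1 {xs = 0 ∷ []}
      (restrict-oddSwaps 1≤2n z<s) secondHalf-starts-with-1
    where
    secondHalf-starts-with-1 : restrict _≟_ (secondHalf n) 0 1 ≡ 1 ∷ 0 ∷ restrict _≟_ (pathEnds n) 0 1
    secondHalf-starts-with-1 = begin
      restrict _≟_ (secondHalf n) 0 1
        ≡⟨ restrict-++ _≟_ (evenSwaps n) (pathEnds n) 0 1 ⟩
      restrict _≟_ (evenSwaps n) 0 1 ++ restrict _≟_ (pathEnds n) 0 1
        ≡⟨ cong (_++ restrict _≟_ (pathEnds n) 0 1) evenSwaps-1-0 ⟩
      1 ∷ 0 ∷ restrict _≟_ (pathEnds n) 0 1
        ∎
      where
      evenSwaps-1-0 : restrict _≟_ (evenSwaps n) 0 1 ≡ 1 ∷ 0 ∷ []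
      evenSwaps-1-0 = trans (restrict-comm _≟_ (evenSwaps n) 0 1) (restrict-evenSwaps 1≤2n z<s)

  zero-last-¬alternate : 0 < n * 2 → ¬ Alternate _≟_ (cycleWord n) 0 (n * 2)
  zero-last-¬alternate 0<2n = ¬linked≢-repeat (0 ∷ n * 2 ∷ []) ∘ subst (Linked _≢_) restriction
    where
    ends : restrict _≟_ (pathEnds n) 0 (n * 2) ≡ 0 ∷ n * 2 ∷ []
    ends = trans (restrict-accept _≟_ (n * 2 ∷ []) 0 (n * 2) (inj₁ refl))
                 (cong (0 ∷_) (restrict-accept _≟_ [] 0 (n * 2) (inj₂ refl)))
    restriction : restrict _≟_ (cycleWord n) 0 (n * 2) ≡ 0 ∷ n * 2 ∷ 0 ∷ 0 ∷ n * 2 ∷ []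
    restriction = begin
      restrict _≟_ (cycleWord n) 0 (n * 2)
        ≡⟨ restrict-cycleWord 0 (n * 2) ⟩
      restrict _≟_ (oddSwaps n) 0 (n * 2) ++ restrict _≟_ (evenSwaps n) 0 (n * 2) ++ restrict _≟_ (pathEnds n) 0 (n * 2)
        ≡⟨ cong₂ _++_ (restrict-oddSwaps ≤-refl (oddSwap-positive 0<2n))
                      (cong₂ _++_ (restrict-evenSwaps-last 0<2n) ends) ⟩
      0 ∷ n * 2 ∷ 0 ∷ 0 ∷ n * 2 ∷ []
        ∎

  successor-¬alternate : ∀ {x} → suc x ≤ n * 2 → ¬ Alternate _≟_ (cycleWord n) x (suc x)
  successor-¬alternate {zero}  = zero-one-¬alternate
  successor-¬alternate {suc k} = path-successor-¬alternate

  cyclicSucc⇒¬alternate : ∀ {x y} → x ≢ y → y ≤ n * 2 →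
                          CyclicSucc (n * 2) x y → ¬ Alternate _≟_ (cycleWord n) x y
  cyclicSucc⇒¬alternate _   y≤2n (inj₁ refl)         = successor-¬alternate y≤2n
  cyclicSucc⇒¬alternate x≢0 _    (inj₂ (refl , refl)) =
    zero-last-¬alternate (≤∧≢⇒< z≤n (x≢0 ∘ sym)) ∘ alternate-sym _≟_ (cycleWord n) (n * 2) 0

  neighbours⇒¬alternate : ∀ {x y} → x ≢ y → x ≤ n * 2 → y ≤ n * 2 →
                          CyclicNeighbours (n * 2) x y → ¬ Alternate _≟_ (cycleWord n) x y
  neighbours⇒¬alternate         x≢y _    y≤2n (inj₁ succ) = cyclicSucc⇒¬alternate x≢y y≤2n succ
  neighbours⇒¬alternate {x} {y} x≢y x≤2n _    (inj₂ succ) =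
    cyclicSucc⇒¬alternate (x≢y ∘ sym) x≤2n succ ∘ alternate-sym _≟_ (cycleWord n) x y

  ordered-¬neighbours⇒alternate : ∀ {x y} → x < y → y ≤ n * 2 →
                                  ¬ CyclicNeighbours (n * 2) x y → Alternate _≟_ (cycleWord n) x y
  ordered-¬neighbours⇒alternate {zero}  {suc zero}    _   _    ¬nb = contradiction (inj₁ (inj₁ refl)) ¬nb
  ordered-¬neighbours⇒alternate {zero}  {suc (suc y)} _   y≤2n ¬nb =
    zero-alternate (s<s z<s) (≤∧≢⇒< y≤2n λ y≡2n → ¬nb (inj₂ (inj₂ (y≡2n , refl))))
  ordered-¬neighbours⇒alternate {suc x} x<y y≤2n ¬nb = path-alternate z<s y≤2n x<y (¬nb ∘ inj₁ ∘ inj₁)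

  ¬neighbours⇒alternate : ∀ {x y} → x ≢ y → x ≤ n * 2 → y ≤ n * 2 →
                          ¬ CyclicNeighbours (n * 2) x y → Alternate _≟_ (cycleWord n) x y
  ¬neighbours⇒alternate {x} {y} x≢y x≤2n y≤2n ¬nb with <-cmp x y
  ... | tri< x<y _ _ = ordered-¬neighbours⇒alternate x<y y≤2n ¬nb
  ... | tri≈ _ x≡y _ = contradiction x≡y x≢y
  ... | tri> _ _ y<x = alternate-sym _≟_ (cycleWord n) y x (ordered-¬neighbours⇒alternate y<x x≤2n (¬nb ∘ Sum.swap))

  cycleWord-alternate⇔¬neighbours : ∀ {x y} → x ≢ y → x ≤ n * 2 → y ≤ n * 2 →
                                    Alternate _≟_ (cycleWord n) x y ⇔ (¬ CyclicNeighbours (n * 2) x y)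
  cycleWord-alternate⇔¬neighbours x≢y x≤2n y≤2n =
    mk⇔ (λ alt nb → neighbours⇒¬alternate x≢y x≤2n y≤2n nb alt) (¬neighbours⇒alternate x≢y x≤2n y≤2n)

*2-injective : ∀ {k l} → k * 2 ≡ l * 2 → k ≡ l
*2-injective {k} {l} = *-cancelʳ-≡ k l 2

even≢odd : ∀ k l → k * 2 ≢ suc (l * 2)
even≢odd zero    _       ()
even≢odd (suc k) zero    eq = contradiction (suc-injective eq) λ ()
even≢odd (suc k) (suc l) eq = even≢odd k l (suc-injective (suc-injective eq))

module _ {n : ℕ} where

  position : Vtx n → ℕ
  position c₀    = 0
  position (a i) = suc (toℕ i * 2)
  position (b i) = suc (toℕ i) * 2

  position-injective : Injective _≡_ _≡_ position
  position-injective {c₀}  {c₀}  _  = refl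
  position-injective {a i} {a j} eq = cong a (toℕ-injective (*2-injective (suc-injective eq)))
  position-injective {a i} {b j} eq = contradiction (suc-injective eq) (even≢odd (toℕ i) (toℕ j))
  position-injective {b i} {a j} eq = contradiction (sym (suc-injective eq)) (even≢odd (toℕ j) (toℕ i))
  position-injective {b i} {b j} eq = cong b (toℕ-injective (suc-injective (*2-injective eq)))
  position-injective {c₀}  {a _} ()
  position-injective {c₀}  {b _} ()
  position-injective {a _} {c₀}  ()
  position-injective {b _} {c₀}  ()

  position-≤ : ∀ u → position u ≤ n * 2
  position-≤ c₀    = z≤n
  position-≤ (a i) = ≤-trans (n≤1+n _) (*-monoˡ-≤ 2 (toℕ<n i))
  position-≤ (b i) = *-monoˡ-≤ 2 (toℕ<n i)

  cycStep⇒cyclicSucc : ∀ {u v} → CycStep n u v → CyclicSucc (n * 2) (position u) (position v)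
  cycStep⇒cyclicSucc {c₀}  {a i} i≡0   = inj₁ (cong (λ k → suc (k * 2)) i≡0)
  cycStep⇒cyclicSucc {a i} {b j} refl  = inj₁ refl
  cycStep⇒cyclicSucc {b i} {a j} i+1≡j = inj₁ (cong (λ k → suc (k * 2)) (sym i+1≡j))
  cycStep⇒cyclicSucc {b i} {c₀}  i+1≡n = inj₂ (cong (_* 2) i+1≡n , refl)

  cyclicSucc⇒cycStep : ∀ {u v} → u ≢ v → CyclicSucc (n * 2) (position u) (position v) → CycStep n u v
  cyclicSucc⇒cycStep {c₀}  {c₀}  u≢v _             = contradiction refl u≢v
  cyclicSucc⇒cycStep {c₀}  {a i} _ (inj₁ eq)       = *2-injective (suc-injective eq)
  cyclicSucc⇒cycStep {a i} {a j} _ (inj₁ eq)       = even≢odd (toℕ j) (toℕ i) (suc-injective eq)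
  cyclicSucc⇒cycStep {a i} {b j} _ (inj₁ eq)       = toℕ-injective (sym (*2-injective (suc-injective (suc-injective eq))))
  cyclicSucc⇒cycStep {a i} {c₀}  _ (inj₂ (eq , _)) = even≢odd n (toℕ i) (sym eq)
  cyclicSucc⇒cycStep {b i} {a j} _ (inj₁ eq)       = sym (*2-injective (suc-injective eq))
  cyclicSucc⇒cycStep {b i} {b j} _ (inj₁ eq)       = even≢odd (toℕ j) (toℕ i) (suc-injective (suc-injective eq))
  cyclicSucc⇒cycStep {b i} {c₀}  _ (inj₂ (eq , _)) = *2-injective eq
  cyclicSucc⇒cycStep {c₀}  {b i} _ (inj₁ ())
  cyclicSucc⇒cycStep {c₀}  {a i} _ (inj₂ (_ , ()))
  cyclicSucc⇒cycStep {c₀}  {b i} _ (inj₂ (_ , ()))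
  cyclicSucc⇒cycStep {a i} {a j} _ (inj₂ (_ , ()))
  cyclicSucc⇒cycStep {a i} {b j} _ (inj₂ (_ , ()))
  cyclicSucc⇒cycStep {a i} {c₀}  _ (inj₁ ())
  cyclicSucc⇒cycStep {b i} {a j} _ (inj₂ (_ , ()))
  cyclicSucc⇒cycStep {b i} {b j} _ (inj₂ (_ , ()))
  cyclicSucc⇒cycStep {b i} {c₀}  _ (inj₁ ())

  nonEdge⇔cyclicNeighbours : ∀ {u v} → u ≢ v → NonEdge n u v ⇔ CyclicNeighbours (n * 2) (position u) (position v)
  nonEdge⇔cyclicNeighbours u≢v = mk⇔ (Sum.map cycStep⇒cyclicSucc cycStep⇒cyclicSucc)
                                     (Sum.map (cyclicSucc⇒cycStep u≢v) (cyclicSucc⇒cycStep (u≢v ∘ sym)))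

shiftVertex : ∀ {n} → Vtx n → Vtx (suc n)
shiftVertex c₀    = c₀
shiftVertex (a i) = a (Fin.suc i)
shiftVertex (b i) = b (Fin.suc i)

pathVertex : ∀ {n} → ℕ → Vtx n
pathVertex {zero}  _             = c₀
pathVertex {suc n} zero          = a Fin.zero
pathVertex {suc n} (suc zero)    = b Fin.zero
pathVertex {suc n} (suc (suc m)) = shiftVertex (pathVertex m)

-- A right inverse of position on 0, …, n * 2 only; beyond that it returns c₀.
vertexAt : ∀ {n} → ℕ → Vtx n
vertexAt zero    = c₀
vertexAt (suc m) = pathVertex m

position-pathVertex : ∀ {n} m → m < n * 2 → position {n} (pathVertex m) ≡ suc m
position-pathVertex {suc n} zero          _ = refl
position-pathVertex {suc n} (suc zero)    _ = refl
position-pathVertex {suc n} (suc (suc m)) (s<s (s<s m<2n)) with pathVertex {n} m | position-pathVertex {n} m m<2n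
... | a i | eq = cong (suc ∘ suc) eq
... | b i | eq = cong (suc ∘ suc) eq

position-vertexAt : ∀ {n} x → x ≤ n * 2 → position (vertexAt {n} x) ≡ x
position-vertexAt     zero    _    = refl
position-vertexAt {n} (suc m) m<2n = position-pathVertex {n} m m<2n

cycleWord-≤ : ∀ n → All (_≤ n * 2) (cycleWord n)
cycleWord-≤ n = ++⁺ (map⁺ (applyUpTo⁺₁ id _ (oddSwap-≤ n ∘ ℕ.s≤s⁻¹)))
                    (++⁺ (map⁺ (applyUpTo⁺₁ id _ (<⇒≤ ∘ evenSwap-< n))) (z≤n ∷ ≤-refl ∷ []))

word : ∀ n → List (Vtx n)
word n = map vertexAt (cycleWord n)

module _ {n : ℕ} where

  map-position-word : map position (word n) ≡ cycleWord n
  map-position-word = begin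
    map position (map vertexAt (cycleWord n))  ≡⟨ map-∘ (cycleWord n) ⟨
    map (position ∘ vertexAt) (cycleWord n)    ≡⟨ map-id-local (All.map (position-vertexAt {n} _) (cycleWord-≤ n)) ⟩
    cycleWord n                                ∎

  word-alternate⇔ : ∀ u v → Alternate _≟V_ (word n) u v ⇔ Alternate _≟_ (cycleWord n) (position u) (position v)
  word-alternate⇔ u v = subst (λ w → Alternate _≟V_ (word n) u v ⇔ Alternate _≟_ w (position u) (position v))
                              map-position-word (alternate-map _≟V_ _≟_ position-injective (word n) u v)

  edge⇔alternate : ∀ {u v} → u ≢ v → Edge6 n u v ⇔ Alternate _≟V_ (word n) u v
  edge⇔alternate {u} {v} u≢v = mk⇔
    (λ (_ , ¬nonEdge) → from (word-alternate⇔ u v) (from positions⇔ (¬nonEdge ∘ from nonEdge⇔)))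
    (λ alt → u≢v , to positions⇔ (to (word-alternate⇔ u v) alt) ∘ to nonEdge⇔)
    where
    open Equivalence
    nonEdge⇔ : NonEdge n u v ⇔ CyclicNeighbours (n * 2) (position u) (position v)
    nonEdge⇔ = nonEdge⇔cyclicNeighbours u≢v
    positions⇔ : Alternate _≟_ (cycleWord n) (position u) (position v) ⇔
                 (¬ CyclicNeighbours (n * 2) (position u) (position v))
    positions⇔ = cycleWord-alternate⇔¬neighbours n (u≢v ∘ position-injective) (position-≤ u) (position-≤ v)

theorem6 : (n : ℕ) → 3 ≤ n → WordRepresentable (Vtx n) _≟V_ (Edge6 n)
theorem6 n _ = word n , λ _ _ → edge⇔alternate
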